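{- Let $n$ be a power of $2$, let $Z[0..n-1]$ be an array, and let $Z'$ be the partial bit reversal of $Z$, i.e. the array obtained by initializing $Z'$ as a copy of $Z$ and then executing $\mathrm{PBR}(Z',n)$ (defined in the context). Then for all integers $p$ with $1\le p<\lg n$ and all integers $i$ with $1\le i\le 2^{p-1}$, \[ Z'\left[2^{p-1}+i-1\right] = Z\left[(2i-1)\,\frac{n}{2^p}\right]. \]
   Context: Procedure $\mathrm{PBR}(Z',s)$, for an array $Z'$ and $s$ a power of $2$: if $s>1$, then (a) with auxiliary arrays $\mathit{Even}[0..s/2-1]$ and $\mathit{Odd}[0..s/2-1]$, for $i=0,\dots,s-1$ set $\mathit{Even}[i/2]:=Z'[i]$ if $i$ is even and $\mathit{Odd}[(i-1)/2]:=Z'[i]$ if $i$ is odd; (b) for $i=0,\dots,s/2-1$ set $Z'[i]:=\mathit{Even}[i]$ and for $i=s/2,\dots,s-1$ set $Z'[i]:=\mathit{Odd}[i-s/2]$; (c) call $\mathrm{PBR}(Z',s/2)$. If $s\le1$ it does nothing. $\lg$ denotes the base-2 logarithm. -}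

module Defs where

open import Data.Nat using (ℕ; zero; suc; _+_; _*_; _∸_; _^_; _≤_; _<_; _≤?_; _<?_; s≤s; z≤n)
open import Data.Nat.Properties
open import Data.Fin using (Fin; toℕ; fromℕ<)
open import Relation.Nullary using (yes; no)
open import Relation.Binary.PropositionalEquality using (_≡_; refl; sym; cong; subst)

at : {A : Set} {n : ℕ} → (Fin n → A) → (j : ℕ) → j < n → A
at Z j lt = Z (fromℕ< lt)

twice< : ∀ {d a} → d < a → suc (2 * d) < 2 * a
twice< {d} {a} lt = ≤-trans (s≤s (≤-reflexive (sym (+-suc d (d + 0)))))
                      (*-monoʳ-≤ 2 lt)

sub< : ∀ i a → a ≤ i → i < 2 * a → i ∸ a < a
sub< i a ge lt = subst (i ∸ a <_) (m+n∸m≡n a a)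
                   (∸-monoˡ-< (subst (i <_) (cong (a +_) (+-identityʳ a)) lt) ge)

evenIx : ∀ {n} m i → 2 ^ suc m ≤ n → i < 2 ^ m → 2 * i < n
evenIx {n} m i le lt = ≤-trans (*-monoʳ-< 2 lt) le

oddIx : ∀ {n} m i → 2 ^ suc m ≤ n → 2 ^ m ≤ i → i < 2 ^ suc m →
        suc (2 * (i ∸ 2 ^ m)) < n
oddIx {n} m i le ge lt = ≤-trans (twice< (sub< i (2 ^ m) ge lt)) le

-- One round (steps (a),(b)) of PBR(Z', s) with s = 2^(suc m), acting on the
-- prefix Z'[0..s-1] of an array of length n ≥ s:
--   Z'[i] := Even[i] = Z'[2i]                 for 0 ≤ i < s/2
--   Z'[i] := Odd[i - s/2] = Z'[2(i-s/2)+1]    for s/2 ≤ i < s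
--   Z'[i] unchanged                            for i ≥ s
step : {A : Set} {n : ℕ} (m : ℕ) → 2 ^ suc m ≤ n → (Fin n → A) → (Fin n → A)
step {n = n} m le Z i with toℕ i <? 2 ^ m
... | yes lt = at Z (2 * toℕ i) (evenIx m (toℕ i) le lt)
... | no ¬lt with toℕ i <? 2 ^ suc m
...   | yes lt2 = at Z (suc (2 * (toℕ i ∸ 2 ^ m)))
                     (oddIx m (toℕ i) le (≮⇒≥ ¬lt) lt2)
...   | no _ = Z i

-- PBR(Z', 2^m) on an array of length n ≥ 2^m:
--   s = 2^0 = 1: do nothing;
--   s = 2^(suc m): one round (a),(b), then PBR(Z', s/2) = PBR(Z', 2^m).
pbr : {A : Set} {n : ℕ} (m : ℕ) → 2 ^ m ≤ n → (Fin n → A) → (Fin n → A)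
pbr zero    le Z = Z
pbr (suc m) le Z = pbr m (≤-trans (m≤m+n (2 ^ m) (2 ^ m + 0)) le) (step m le Z)

partialBitReversal : {A : Set} (k : ℕ) → (Fin (2 ^ k) → A) → (Fin (2 ^ k) → A)
partialBitReversal k Z = pbr k ≤-refl Z

module Submission where

open import Defs
open import Data.Nat using (ℕ; zero; suc; _+_; _*_; _∸_; _^_; _≤_; _<_; _<?_; NonZero)
open import Data.Nat.DivMod using (_/_; m*n/n≡m)
open import Data.Nat.Properties
open import Data.Fin using (Fin; toℕ; fromℕ<)
open import Data.Fin.Properties using (toℕ-fromℕ<)
open import Relation.Nullary using (yes; no)
open import Relation.Nullary.Negation using (contradiction)
open import Relation.Binary.PropositionalEquality
open import Algebra.Properties.CommutativeSemigroup *-commutativeSemigroup using (x∙yz≈y∙xz)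

-- PBR(Z′, 2^k) runs one round on each prefix of length 2^k, …, 2^1; the
-- round on length 2^(m+1) moves Z′[2j] to position j and Z′[2j+1] to
-- position 2^m + j.  Trace position 2^q + r (r < 2^q) back through the rounds:
-- the rounds on prefixes of length at most 2^q leave it alone, the round on
-- length 2^(q+1) fetches it from position 2r+1, and each of the d rounds
-- before that doubles the source position.  So it ends up holding
-- Z[(2r+1)·2^d], which is the claim for p = q+1, i = r+1 and k = d+p.

-- The bound is an irrelevant argument of fromℕ<, so any two proofs will do.
at-cong : {A : Set} {n : ℕ} (Z : Fin n → A) {j j′ : ℕ} → j ≡ j′ →
          (lt : j < n) (lt′ : j′ < n) → at Z j lt ≡ at Z j′ lt′
at-cong Z refl _ _ = refl

2^m≤2^[1+m] : ∀ m → 2 ^ m ≤ 2 ^ suc m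
2^m≤2^[1+m] m = m≤m+n (2 ^ m) (2 ^ m + 0)

2^m+j<2^[1+m] : ∀ m {j} → j < 2 ^ m → 2 ^ m + j < 2 ^ suc m
2^m+j<2^[1+m] m {j} j<2^m =
  subst (2 ^ m + j <_) (cong (2 ^ m +_) (sym (+-identityʳ (2 ^ m))))
        (+-monoʳ-< (2 ^ m) j<2^m)

module _ {A : Set} {n : ℕ} (m : ℕ) (le : 2 ^ suc m ≤ n) (Z : Fin n → A) where

  step-even : ∀ {j} (i : Fin n) → toℕ i ≡ j → j < 2 ^ m → (lt : 2 * j < n) →
              step m le Z i ≡ at Z (2 * j) lt
  step-even i refl j<2^m _ with toℕ i <? 2 ^ m
  ... | yes _     = refl
  ... | no j≮2^m  = contradiction j<2^m j≮2^m

  step-odd : ∀ {j} (i : Fin n) → toℕ i ≡ 2 ^ m + j → j < 2 ^ m →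
             (lt : suc (2 * j) < n) → step m le Z i ≡ at Z (suc (2 * j)) lt
  step-odd {j} i i≡2^m+j j<2^m lt with toℕ i <? 2 ^ m
  ... | yes i<2^m = contradiction (subst (_< 2 ^ m) i≡2^m+j i<2^m) (m+n≮m (2 ^ m) j)
  ... | no _ with toℕ i <? 2 ^ suc m
  ...   | yes _ = at-cong Z (cong (λ x → suc (2 * x)) i∸2^m≡j)
                        (subst (λ x → suc (2 * x) < n) (sym i∸2^m≡j) lt) lt
    where
    i∸2^m≡j : toℕ i ∸ 2 ^ m ≡ j
    i∸2^m≡j = trans (cong (_∸ 2 ^ m) i≡2^m+j) (m+n∸m≡n (2 ^ m) j)
  ...   | no i≮2^[1+m] =
    contradiction (subst (_< 2 ^ suc m) (sym i≡2^m+j) (2^m+j<2^[1+m] m j<2^m)) i≮2^[1+m]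

  step-high : ∀ {j} (i : Fin n) → toℕ i ≡ j → 2 ^ suc m ≤ j → step m le Z i ≡ Z i
  step-high i refl 2^[1+m]≤j with toℕ i <? 2 ^ m
  ... | yes j<2^m = contradiction (≤-trans (2^m≤2^[1+m] m) 2^[1+m]≤j) (<⇒≱ j<2^m)
  ... | no _ with toℕ i <? 2 ^ suc m
  ...   | yes j<2^[1+m] = contradiction 2^[1+m]≤j (<⇒≱ j<2^[1+m])
  ...   | no _          = refl

pbr-high : {A : Set} {n : ℕ} (m : ℕ) (le : 2 ^ m ≤ n) (Z : Fin n → A) {j : ℕ} →
           2 ^ m ≤ j → (lt : j < n) → at (pbr m le Z) j lt ≡ at Z j lt
pbr-high zero    le Z _       lt = refl
pbr-high (suc m) le Z 2^m≤j lt =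
  trans (pbr-high m _ (step m le Z) (≤-trans (2^m≤2^[1+m] m) 2^m≤j) lt)
        (step-high m le Z (fromℕ< lt) (toℕ-fromℕ< lt) 2^m≤j)

[1+2r]*2^d<2^[d+1+q] : ∀ d q {r} → r < 2 ^ q → suc (2 * r) * 2 ^ d < 2 ^ (d + suc q)
[1+2r]*2^d<2^[d+1+q] d q {r} r<2^q = begin-strict
  suc (2 * r) * 2 ^ d  <⟨ *-monoˡ-< (2 ^ d) {{m^n≢0 2 d}} (twice< r<2^q) ⟩
  2 ^ suc q * 2 ^ d    ≡⟨ *-comm (2 ^ suc q) (2 ^ d) ⟩
  2 ^ d * 2 ^ suc q    ≡⟨ ^-distribˡ-+-* 2 d (suc q) ⟨
  2 ^ (d + suc q)      ∎
  where open ≤-Reasoning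

pbr-odd-position : {A : Set} {n : ℕ} (d q : ℕ) (le : 2 ^ (d + suc q) ≤ n)
                   (Z : Fin n → A) {r : ℕ} → r < 2 ^ q →
                   (lt : 2 ^ q + r < n) (lt′ : suc (2 * r) * 2 ^ d < n) →
                   at (pbr (d + suc q) le Z) (2 ^ q + r) lt ≡ at Z (suc (2 * r) * 2 ^ d) lt′
pbr-odd-position {n = n} zero q le Z {r} r<2^q lt lt′ = begin
  at (pbr q _ (step q le Z)) (2 ^ q + r) lt  ≡⟨ pbr-high q _ (step q le Z) (m≤m+n (2 ^ q) r) lt ⟩
  at (step q le Z) (2 ^ q + r) lt            ≡⟨ step-odd q le Z (fromℕ< lt) (toℕ-fromℕ< lt) r<2^q lt₁ ⟩
  at Z (suc (2 * r)) lt₁                     ≡⟨ at-cong Z (sym (*-identityʳ (suc (2 * r)))) lt₁ lt′ ⟩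
  at Z (suc (2 * r) * 1) lt′                 ∎
  where
  open ≡-Reasoning
  lt₁ : suc (2 * r) < n
  lt₁ = subst (_< n) (*-identityʳ (suc (2 * r))) lt′
pbr-odd-position {n = n} (suc d) q le Z {r} r<2^q lt lt′ = begin
  at (pbr (d + suc q) le′ (step (d + suc q) le Z)) (2 ^ q + r) lt
    ≡⟨ pbr-odd-position d q le′ (step (d + suc q) le Z) r<2^q lt lt₁ ⟩
  at (step (d + suc q) le Z) (suc (2 * r) * 2 ^ d) lt₁
    ≡⟨ step-even (d + suc q) le Z (fromℕ< lt₁) (toℕ-fromℕ< lt₁) bound lt₂ ⟩
  at Z (2 * (suc (2 * r) * 2 ^ d)) lt₂
    ≡⟨ at-cong Z (x∙yz≈y∙xz 2 (suc (2 * r)) (2 ^ d)) lt₂ lt′ ⟩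
  at Z (suc (2 * r) * 2 ^ suc d) lt′
    ∎
  where
  open ≡-Reasoning
  le′ : 2 ^ (d + suc q) ≤ n
  le′ = ≤-trans (2^m≤2^[1+m] (d + suc q)) le
  bound : suc (2 * r) * 2 ^ d < 2 ^ (d + suc q)
  bound = [1+2r]*2^d<2^[d+1+q] d q r<2^q
  lt₁ : suc (2 * r) * 2 ^ d < n
  lt₁ = ≤-trans bound le′
  lt₂ : 2 * (suc (2 * r) * 2 ^ d) < n
  lt₂ = subst (_< n) (sym (x∙yz≈y∙xz 2 (suc (2 * r)) (2 ^ d))) lt′

lemma3 : {A : Set} (k : ℕ) (Z : Fin (2 ^ k) → A) (p i : ℕ) →
    1 ≤ p → p < k → 1 ≤ i → i ≤ 2 ^ (p ∸ 1) →
    (lt₁ : 2 ^ (p ∸ 1) + i ∸ 1 < 2 ^ k) →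
    (lt₂ : (2 * i ∸ 1) * (Data.Nat.DivMod._/_ (2 ^ k) (2 ^ p) {{m^n≢0 2 p}}) < 2 ^ k) →
    at (partialBitReversal k Z) (2 ^ (p ∸ 1) + i ∸ 1) lt₁ ≡ at Z ((2 * i ∸ 1) * (Data.Nat.DivMod._/_ (2 ^ k) (2 ^ p) {{m^n≢0 2 p}})) lt₂
lemma3 k Z (suc q) (suc r) _ q<k _ r<2^q lt₁ lt₂
  with k ∸ suc q | m∸n+n≡m (<⇒≤ q<k)
... | d | refl = begin
  at (pbr (d + suc q) ≤-refl Z) (2 ^ q + suc r ∸ 1) lt₁  ≡⟨ at-cong (pbr (d + suc q) ≤-refl Z) position lt₁ lt ⟩
  at (pbr (d + suc q) ≤-refl Z) (2 ^ q + r) lt         ≡⟨ pbr-odd-position d q ≤-refl Z r<2^q lt lt′ ⟩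
  at Z (suc (2 * r) * 2 ^ d) lt′                       ≡⟨ at-cong Z (sym source) lt′ lt₂ ⟩
  at Z ((2 * suc r ∸ 1) * (2 ^ (d + suc q) / 2 ^ suc q)) lt₂  ∎
  where
  open ≡-Reasoning
  instance
    2^[1+q]≢0 : NonZero (2 ^ suc q)
    2^[1+q]≢0 = m^n≢0 2 (suc q)
  position : 2 ^ q + suc r ∸ 1 ≡ 2 ^ q + r
  position = cong (_∸ 1) (+-suc (2 ^ q) r)
  source : (2 * suc r ∸ 1) * (2 ^ (d + suc q) / 2 ^ suc q) ≡ suc (2 * r) * 2 ^ d
  source = cong₂ _*_ (cong (_∸ 1) (*-distribˡ-+ 2 1 r))
                     (trans (cong (_/ 2 ^ suc q) (^-distribˡ-+-* 2 d (suc q)))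
                            (m*n/n≡m (2 ^ d) (2 ^ suc q)))
  lt : 2 ^ q + r < 2 ^ (d + suc q)
  lt = subst (_< 2 ^ (d + suc q)) position lt₁
  lt′ : suc (2 * r) * 2 ^ d < 2 ^ (d + suc q)
  lt′ = subst (_< 2 ^ (d + suc q)) source lt₂
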